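{- Let $\mathscr{A}$ be a closed set of games with mis\`ere quotient map $\Phi:\mathscr{A}\to\mathcal{Q}(\mathscr{A})$, and let $G$ be a game all of whose options lie in $\mathscr{A}$. Suppose there is $H\in\mathscr{A}$ such that $\{\Phi(G') : G' \text{ an option of } G\}=\{\Phi(H') : H' \text{ an option of } H\}$. Then $\mathcal{Q}(\mathrm{cl}(\mathscr{A}\cup\{G\}))\cong\mathcal{Q}(\mathscr{A})$, and under this isomorphism the quotient map of $\mathrm{cl}(\mathscr{A}\cup\{G\})$ agrees with $\Phi$ on $\mathscr{A}$ and sends $G$ to $\Phi(H)$; in short, $\Phi(G)=\Phi(H)$.
   Context: Games are finite, loopfree impartial games identified up to isomorphism with their sets of options ($0=\{\}$); disjunctive sum $G+H=\{G'+H\}\cup\{G+H'\}$. Mis\`ere outcome: $o^-(G)=\mathscr{P}$ iff $G\neq0$ and every option has outcome $\mathscr{N}$; otherwise $\mathscr{N}$. A set of games is closed if closed under sum and under taking options; $\mathrm{cl}(\mathscr{B})$ is the closure under sum of the set of all subpositions of games in $\mathscr{B}$. For closed $\mathscr{A}$ and $G,H\in\mathscr{A}$, $G\equiv_\mathscr{A}H$ iff $o^-(G+X)=o^-(H+X)$ for all $X\in\mathscr{A}$. The mis\`ere quotient $\mathcal{Q}(\mathscr{A})$ is the bipartite monoid $(\mathscr{A}/\!\equiv_\mathscr{A},\ \{[X]:o^-(X)=\mathscr{P}\})$ (a commutative monoid together with a distinguished subset), and $\Phi(X)=[X]$ is the quotient map. Isomorphism of such pairs means a monoid isomorphism preserving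 the distinguished subsets in both directions. -}

module Defs where

open import Data.List using (List; []; _∷_; _++_)
open import Data.List.Membership.Propositional using (_∈_)
open import Data.Product using (Σ; _×_; _,_)
open import Data.Sum using (_⊎_)
open import Function.Bundles using (_⇔_)
open import Relation.Binary.PropositionalEquality using (_≡_)

-- Finite loopfree impartial games, represented by their (finite) lists of options.
data Game : Set where
  node : List Game → Game

options : Game → List Game
options (node gs) = gs

𝟘 : Game
𝟘 = node []

mutual
  _⊕_ : Game → Game → Game
  G@(node gs) ⊕ H@(node hs) = node (leftMoves gs H ++ rightMoves G hs)

  leftMoves : List Game → Game → List Game
  leftMoves []       H = []
  leftMoves (g ∷ gs) H = (g ⊕ H) ∷ leftMoves gs H

  rightMoves : Game → List Game → List Game
  rightMoves G []       = []
  rightMoves G (h ∷ hs) = (G ⊕ h) ∷ rightMoves G hs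

data Outcome : Set where
  𝒫 𝒩 : Outcome

mutual
  outcome : Game → Outcome
  outcome (node [])       = 𝒩
  outcome (node (g ∷ gs)) = allN (g ∷ gs)

  allN : List Game → Outcome
  allN []       = 𝒫
  allN (g ∷ gs) with outcome g
  ... | 𝒩 = allN gs
  ... | 𝒫 = 𝒩

GameSet : Set₁
GameSet = Game → Set

record Closed (A : GameSet) : Set where
  field
    sum-closed    : ∀ X Y → A X → A Y → A (X ⊕ Y)
    option-closed : ∀ X X′ → A X → X′ ∈ options X → A X′

data Subpos : Game → Game → Set where
  here  : ∀ {X} → Subpos X X
  there : ∀ {X X′ Y} → X′ ∈ options X → Subpos X′ Y → Subpos X Y

data Cl (B : GameSet) : GameSet where
  sub  : ∀ {X Y} → B X → Subpos X Y → Cl B Y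
  plus : ∀ {X Y} → Cl B X → Cl B Y → Cl B (X ⊕ Y)

_∪｛_｝ : GameSet → Game → GameSet
(A ∪｛ G ｝) X = A X ⊎ X ≡ G

_≈[_]_ : Game → GameSet → Game → Set
X ≈[ A ] Y = ∀ Z → A Z → outcome (X ⊕ Z) ≡ outcome (Y ⊕ Z)

-- [X] lies in the distinguished subset {[Y] : o⁻(Y) = 𝒫} of 𝒬(A)
InPPortion : GameSet → Game → Set
InPPortion A X = Σ Game λ Y → A Y × (Y ≈[ A ] X) × (outcome Y ≡ 𝒫)

-- An isomorphism of bipartite monoids 𝒬(B) ≅ 𝒬(A), presented on representatives:
-- ψ sends (a representative of) a class of 𝒬(B) to a representative of a class of 𝒬(A).
record QuotientIso (B A : GameSet) : Set where
  field
    ψ      : ∀ X → B X → Game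
    ψ-mem  : ∀ X (b : B X) → A (ψ X b)
    ψ-cong : ∀ X Y (b : B X) (c : B Y) → X ≈[ B ] Y → ψ X b ≈[ A ] ψ Y c
    ψ-inj  : ∀ X Y (b : B X) (c : B Y) → ψ X b ≈[ A ] ψ Y c → X ≈[ B ] Y
    ψ-surj : ∀ Y → A Y → Σ Game λ X → Σ (B X) λ b → ψ X b ≈[ A ] Y
    ψ-hom  : ∀ X Y (b : B X) (c : B Y) (d : B (X ⊕ Y)) →
             ψ (X ⊕ Y) d ≈[ A ] (ψ X b ⊕ ψ Y c)
    ψ-unit : (b : B 𝟘) → ψ 𝟘 b ≈[ A ] 𝟘
    ψ-P    : ∀ X (b : B X) → InPPortion B X ⇔ InPPortion A (ψ X b)

SameOptionClasses : GameSet → Game → Game → Set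
SameOptionClasses A G H =
  (∀ G′ → G′ ∈ options G → Σ Game λ H′ → H′ ∈ options H × (G′ ≈[ A ] H′)) ×
  (∀ H′ → H′ ∈ options H → Σ Game λ G′ → G′ ∈ options G × (H′ ≈[ A ] G′))

{-# OPTIONS --safe #-}
-- Every position of cl(A ∪ {G}) is, up to isomorphism of game trees, a sum a + n·G with a ∈ A, and the
-- isomorphism of quotients sends it to a + n·H. The crux is that n·G ≡_A n·H for every n. As A is closed
-- under options, two games whose options can be matched up to ≡_A are ≡_A-equivalent themselves; and an
-- option G′ + (n-1)·G of n·G is matched by the option H′ + (n-1)·H of n·H with Φ(G′) = Φ(H′), since
-- G′ + (n-1)·G ≡_A G′ + (n-1)·H ≡_A H′ + (n-1)·H by induction, G′ and (n-1)·H lying in A. Hence every sum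
-- of positions of cl(A ∪ {G}) has the same outcome as its image in A, which gives all the properties of
-- the isomorphism at once.
module Submission where

open import Defs
open import Algebra.Bundles using (CommutativeMonoid)
open import Algebra.Structures using (IsCommutativeMonoid)
open import Data.List using ([]; _∷_; _++_; map)
open import Data.List.Properties using (++-identityʳ)
open import Data.List.Membership.Propositional using (_∈_)
open import Data.List.Membership.Propositional.Properties using (∈-map⁺; ∈-map⁻; ∈-++⁺ˡ; ∈-++⁺ʳ; ∈-++⁻)
open import Data.List.Relation.Unary.All using (All; []; _∷_; lookup; tabulate)
open import Data.List.Relation.Unary.Any using (here; there)
open import Data.Nat using (zero; suc; _+_)
open import Data.Product using (Σ; ∃; ∃₂; _×_; _,_; proj₁; proj₂)
open import Data.Sum using (inj₁; inj₂)
open import Function.Base using (_on_)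
open import Function.Bundles using (_⇔_; mk⇔)
open import Induction.WellFounded using (Acc; acc; WellFounded)
open import Relation.Binary.Definitions using (Symmetric)
open import Relation.Binary.PropositionalEquality using (_≡_; refl; sym; trans; cong; cong₂; subst; module ≡-Reasoning)

infix 4 _≺_

_≺_ : Game → Game → Set
X′ ≺ X = X′ ∈ options X

≺-wellFounded : WellFounded _≺_
≺-wellFounded (node xs) = acc (accessible xs)
  where
  accessible : ∀ xs {x} → x ∈ xs → Acc _≺_ x
  accessible (x ∷ _)  (here refl)  = ≺-wellFounded x
  accessible (_ ∷ xs) (there x∈xs) = accessible xs x∈xs

leftMoves≡map : ∀ xs Y → leftMoves xs Y ≡ map (_⊕ Y) xs
leftMoves≡map []       Y = refl
leftMoves≡map (x ∷ xs) Y = cong (x ⊕ Y ∷_) (leftMoves≡map xs Y)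

rightMoves≡map : ∀ X ys → rightMoves X ys ≡ map (X ⊕_) ys
rightMoves≡map X []       = refl
rightMoves≡map X (y ∷ ys) = cong (X ⊕ y ∷_) (rightMoves≡map X ys)

options-⊕ : ∀ X Y → options (X ⊕ Y) ≡ map (_⊕ Y) (options X) ++ map (X ⊕_) (options Y)
options-⊕ X@(node xs) Y@(node ys) = cong₂ _++_ (leftMoves≡map xs Y) (rightMoves≡map X ys)

≺-⊕ˡ : ∀ X Y {X′} → X′ ≺ X → X′ ⊕ Y ≺ X ⊕ Y
≺-⊕ˡ X Y x′ = subst (_ ∈_) (sym (options-⊕ X Y)) (∈-++⁺ˡ (∈-map⁺ (_⊕ Y) x′))

≺-⊕ʳ : ∀ X Y {Y′} → Y′ ≺ Y → X ⊕ Y′ ≺ X ⊕ Y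
≺-⊕ʳ X Y y′ = subst (_ ∈_) (sym (options-⊕ X Y)) (∈-++⁺ʳ _ (∈-map⁺ (X ⊕_) y′))

data OptionOfSum (X Y : Game) : Game → Set where
  left  : ∀ {X′} → X′ ≺ X → OptionOfSum X Y (X′ ⊕ Y)
  right : ∀ {Y′} → Y′ ≺ Y → OptionOfSum X Y (X ⊕ Y′)

optionOfSum : ∀ X Y {W} → W ≺ X ⊕ Y → OptionOfSum X Y W
optionOfSum X Y w with ∈-++⁻ (map (_⊕ Y) (options X)) (subst (_ ∈_) (options-⊕ X Y) w)
... | inj₁ w∈ with ∈-map⁻ (_⊕ Y) w∈
...   | _ , x′ , refl = left x′
optionOfSum X Y w | inj₂ w∈ with ∈-map⁻ (X ⊕_) w∈
...   | _ , y′ , refl = right y′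

mutual
  ⊕-identityʳ : ∀ X → X ⊕ 𝟘 ≡ X
  ⊕-identityʳ (node xs) = cong node (trans (++-identityʳ _) (leftMoves-𝟘 xs))

  leftMoves-𝟘 : ∀ xs → leftMoves xs 𝟘 ≡ xs
  leftMoves-𝟘 []       = refl
  leftMoves-𝟘 (x ∷ xs) = cong₂ _∷_ (⊕-identityʳ x) (leftMoves-𝟘 xs)

mutual
  ⊕-identityˡ : ∀ X → 𝟘 ⊕ X ≡ X
  ⊕-identityˡ (node xs) = cong node (𝟘-rightMoves xs)

  𝟘-rightMoves : ∀ xs → rightMoves 𝟘 xs ≡ xs
  𝟘-rightMoves []       = refl
  𝟘-rightMoves (x ∷ xs) = cong₂ _∷_ (⊕-identityˡ x) (𝟘-rightMoves xs)

record Matched (R : Game → Game → Set) (U V : Game) : Set where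
  field
    forth : ∀ {U′} → U′ ≺ U → ∃ λ V′ → V′ ≺ V × R U′ V′
    back  : ∀ {V′} → V′ ≺ V → ∃ λ U′ → U′ ≺ U × R U′ V′
open Matched

Matched-sym : ∀ {R} → Symmetric R → ∀ {U V} → Matched R U V → Matched R V U
Matched-sym R-sym m = record
  { forth = λ v → let (U′ , u , r) = back m v in U′ , u , R-sym r
  ; back  = λ u → let (V′ , v , r) = forth m u in V′ , v , R-sym r
  }

allN-sound : ∀ xs → allN xs ≡ 𝒫 → All (λ x → outcome x ≡ 𝒩) xs
allN-sound []       _ = []
allN-sound (x ∷ xs) e with outcome x in eq
... | 𝒩 = eq ∷ allN-sound xs e

allN-complete : ∀ {xs} → All (λ x → outcome x ≡ 𝒩) xs → allN xs ≡ 𝒫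
allN-complete []                       = refl
allN-complete {x ∷ _} (x𝒩 ∷ xs𝒩) rewrite x𝒩 = allN-complete xs𝒩

𝒫-transfer : ∀ {U V} → Matched (_≡_ on outcome) U V → outcome U ≡ 𝒫 → outcome V ≡ 𝒫
𝒫-transfer {node (u ∷ us)} {node []} m _ with forth m (here refl)
... | _ , () , _
𝒫-transfer {node (u ∷ us)} {node (v ∷ vs)} m U𝒫 = allN-complete (tabulate options𝒩)
  where
  options𝒩 : ∀ {V′} → V′ ∈ v ∷ vs → outcome V′ ≡ 𝒩
  options𝒩 v′ = let (U′ , u′ , eq) = back m v′ in trans (sym eq) (lookup (allN-sound (u ∷ us) U𝒫) u′)

≡-by-𝒫 : ∀ {a b : Outcome} → (a ≡ 𝒫 → b ≡ 𝒫) → (b ≡ 𝒫 → a ≡ 𝒫) → a ≡ b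
≡-by-𝒫 {𝒫} {𝒫} _ _ = refl
≡-by-𝒫 {𝒩} {𝒩} _ _ = refl
≡-by-𝒫 {𝒫} {𝒩} a⇒b _ = sym (a⇒b refl)
≡-by-𝒫 {𝒩} {𝒫} _ b⇒a = b⇒a refl

outcome-≡-byOptions : ∀ {U V} → Matched (_≡_ on outcome) U V → outcome U ≡ outcome V
outcome-≡-byOptions m = ≡-by-𝒫 (𝒫-transfer m) (𝒫-transfer (Matched-sym sym m))

-- Bisimilarity of game trees: a sum lists its options in a fixed order, so ⊕ is commutative only up to ≅.
infix 4 _≅_

data _≅_ (U V : Game) : Set where
  iso : Matched _≅_ U V → U ≅ V

≅-refl : ∀ {X} → X ≅ X
≅-refl = go (≺-wellFounded _)
  where
  go : ∀ {X} → Acc _≺_ X → X ≅ X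
  go (acc rec) = iso record
    { forth = λ x′ → _ , x′ , go (rec x′)
    ; back  = λ x′ → _ , x′ , go (rec x′)
    }

≅-reflexive : ∀ {X Y} → X ≡ Y → X ≅ Y
≅-reflexive refl = ≅-refl

≅-sym : ∀ {U V} → U ≅ V → V ≅ U
≅-sym (iso m) = iso record
  { forth = λ v → let (U′ , u , p) = back m v in U′ , u , ≅-sym p
  ; back  = λ u → let (V′ , v , p) = forth m u in V′ , v , ≅-sym p
  }

≅-trans : ∀ {U V W} → U ≅ V → V ≅ W → U ≅ W
≅-trans (iso m) (iso n) = iso record
  { forth = λ u → let (V′ , v , p) = forth m u ; (W′ , w , q) = forth n v in W′ , w , ≅-trans p q
  ; back  = λ w → let (V′ , v , q) = back n w ; (U′ , u , p) = back m v in U′ , u , ≅-trans p q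
  }

≅⇒outcome≡ : ∀ {U V} → U ≅ V → outcome U ≡ outcome V
≅⇒outcome≡ {U} {V} (iso m) = outcome-≡-byOptions {U} {V} record
  { forth = λ u → let (V′ , v , p) = forth m u in V′ , v , ≅⇒outcome≡ p
  ; back  = λ v → let (U′ , u , p) = back m v in U′ , u , ≅⇒outcome≡ p
  }

⊕-cong : ∀ {X X′ Y Y′} → X ≅ X′ → Y ≅ Y′ → X ⊕ Y ≅ X′ ⊕ Y′
⊕-cong {X} {X′} {Y} {Y′} p@(iso m) q@(iso n) = iso record { forth = forth′ ; back = back′ }
  where
  forth′ : ∀ {W} → W ≺ X ⊕ Y → ∃ λ W′ → W′ ≺ X′ ⊕ Y′ × W ≅ W′
  forth′ w with optionOfSum X Y w
  ... | left x₁  = let (X₁′ , x₁′ , p₁) = forth m x₁ in X₁′ ⊕ Y′ , ≺-⊕ˡ X′ Y′ x₁′ , ⊕-cong p₁ q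
  ... | right y₁ = let (Y₁′ , y₁′ , q₁) = forth n y₁ in X′ ⊕ Y₁′ , ≺-⊕ʳ X′ Y′ y₁′ , ⊕-cong p q₁
  back′ : ∀ {W′} → W′ ≺ X′ ⊕ Y′ → ∃ λ W → W ≺ X ⊕ Y × W ≅ W′
  back′ w′ with optionOfSum X′ Y′ w′
  ... | left x₁′  = let (X₁ , x₁ , p₁) = back m x₁′ in X₁ ⊕ Y , ≺-⊕ˡ X Y x₁ , ⊕-cong p₁ q
  ... | right y₁′ = let (Y₁ , y₁ , q₁) = back n y₁′ in X ⊕ Y₁ , ≺-⊕ʳ X Y y₁ , ⊕-cong p q₁

⊕-comm : ∀ X Y → X ⊕ Y ≅ Y ⊕ X
⊕-comm X Y = go (≺-wellFounded (X ⊕ Y))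
  where
  go : ∀ {X Y} → Acc _≺_ (X ⊕ Y) → X ⊕ Y ≅ Y ⊕ X
  go {X} {Y} (acc rec) = iso record { forth = forth′ ; back = back′ }
    where
    forth′ : ∀ {W} → W ≺ X ⊕ Y → ∃ λ W′ → W′ ≺ Y ⊕ X × W ≅ W′
    forth′ w with optionOfSum X Y w
    ... | left x′  = _ , ≺-⊕ʳ Y X x′ , go (rec w)
    ... | right y′ = _ , ≺-⊕ˡ Y X y′ , go (rec w)
    back′ : ∀ {W′} → W′ ≺ Y ⊕ X → ∃ λ W → W ≺ X ⊕ Y × W ≅ W′
    back′ w′ with optionOfSum Y X w′
    ... | left y′  = let w = ≺-⊕ʳ X Y y′ in _ , w , go (rec w)
    ... | right x′ = let w = ≺-⊕ˡ X Y x′ in _ , w , go (rec w)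

⊕-assoc : ∀ X Y Z → (X ⊕ Y) ⊕ Z ≅ X ⊕ (Y ⊕ Z)
⊕-assoc X Y Z = go (≺-wellFounded ((X ⊕ Y) ⊕ Z))
  where
  go : ∀ {X Y Z} → Acc _≺_ ((X ⊕ Y) ⊕ Z) → (X ⊕ Y) ⊕ Z ≅ X ⊕ (Y ⊕ Z)
  go {X} {Y} {Z} (acc rec) = iso record { forth = forth′ ; back = back′ }
    where
    forth′ : ∀ {W} → W ≺ (X ⊕ Y) ⊕ Z → ∃ λ W′ → W′ ≺ X ⊕ (Y ⊕ Z) × W ≅ W′
    forth′ w with optionOfSum (X ⊕ Y) Z w
    ... | right z′ = _ , ≺-⊕ʳ X (Y ⊕ Z) (≺-⊕ʳ Y Z z′) , go (rec w)
    ... | left xy′ with optionOfSum X Y xy′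
    ...   | left x′  = _ , ≺-⊕ˡ X (Y ⊕ Z) x′ , go (rec w)
    ...   | right y′ = _ , ≺-⊕ʳ X (Y ⊕ Z) (≺-⊕ˡ Y Z y′) , go (rec w)
    back′ : ∀ {W′} → W′ ≺ X ⊕ (Y ⊕ Z) → ∃ λ W → W ≺ (X ⊕ Y) ⊕ Z × W ≅ W′
    back′ w′ with optionOfSum X (Y ⊕ Z) w′
    ... | left x′ = let w = ≺-⊕ˡ (X ⊕ Y) Z (≺-⊕ˡ X Y x′) in _ , w , go (rec w)
    ... | right yz′ with optionOfSum Y Z yz′
    ...   | left y′  = let w = ≺-⊕ˡ (X ⊕ Y) Z (≺-⊕ʳ X Y y′) in _ , w , go (rec w)
    ...   | right z′ = let w = ≺-⊕ʳ (X ⊕ Y) Z z′ in _ , w , go (rec w)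

⊕-isCommutativeMonoid : IsCommutativeMonoid _≅_ _⊕_ 𝟘
⊕-isCommutativeMonoid = record
  { isMonoid = record
    { isSemigroup = record
      { isMagma = record
        { isEquivalence = record { refl = ≅-refl ; sym = ≅-sym ; trans = ≅-trans }
        ; ∙-cong = ⊕-cong
        }
      ; assoc = ⊕-assoc
      }
    ; identity = (λ X → ≅-reflexive (⊕-identityˡ X)) , (λ X → ≅-reflexive (⊕-identityʳ X))
    }
  ; comm = ⊕-comm
  }

⊕-commutativeMonoid : CommutativeMonoid _ _
⊕-commutativeMonoid = record { isCommutativeMonoid = ⊕-isCommutativeMonoid }

open CommutativeMonoid ⊕-commutativeMonoid using (setoid; monoid; commutativeSemigroup; identityˡ; identityʳ)
open import Algebra.Properties.CommutativeSemigroup commutativeSemigroup using (interchange; x∙yz≈y∙xz; xy∙z≈y∙xz)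
open import Algebra.Properties.Monoid.Mult monoid using (×-homo-1; ×-homo-+) renaming (_×_ to _·_)
import Relation.Binary.Reasoning.Setoid setoid as ≅-Reasoning

option-· : ∀ K n {W} → W ≺ suc n · K → ∃ λ K′ → K′ ≺ K × W ≅ K′ ⊕ (n · K)
option-· K n w with optionOfSum K (n · K) w
option-· K n       w | left k′  = _ , k′ , ≅-refl
option-· K (suc n) w | right w′ =
  let (K′ , k′ , W′≅) = option-· K n w′
  in K′ , k′ , ≅-trans (⊕-cong ≅-refl W′≅) (x∙yz≈y∙xz K K′ (n · K))

module _ {A : GameSet} (closed : Closed A) where
  open Closed closed

  subpos-closed : ∀ {X Y} → A X → Subpos X Y → A Y
  subpos-closed x here          = x
  subpos-closed x (there x′ p)  = subpos-closed (option-closed _ _ x x′) p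

  𝟘-closed : ∀ X → A X → A 𝟘
  𝟘-closed (node [])      x = x
  𝟘-closed (node (y ∷ _)) x = 𝟘-closed y (option-closed _ y x (here refl))

  ·-closed : A 𝟘 → ∀ {K} → A K → ∀ n → A (n · K)
  ·-closed z k zero    = z
  ·-closed z k (suc n) = sum-closed _ _ k (·-closed z k n)

  ≈-⊕-congˡ : ∀ {X Y W} → A W → X ≈[ A ] Y → (X ⊕ W) ≈[ A ] (Y ⊕ W)
  ≈-⊕-congˡ {X} {Y} {W} w X≈Y Z z = begin
    outcome ((X ⊕ W) ⊕ Z)  ≡⟨ ≅⇒outcome≡ (⊕-assoc X W Z) ⟩
    outcome (X ⊕ (W ⊕ Z))  ≡⟨ X≈Y (W ⊕ Z) (sum-closed W Z w z) ⟩
    outcome (Y ⊕ (W ⊕ Z))  ≡⟨ ≅⇒outcome≡ (≅-sym (⊕-assoc Y W Z)) ⟩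
    outcome ((Y ⊕ W) ⊕ Z)  ∎
    where open ≡-Reasoning

  ≈-⊕-congʳ : ∀ {X Y W} → A W → X ≈[ A ] Y → (W ⊕ X) ≈[ A ] (W ⊕ Y)
  ≈-⊕-congʳ {X} {Y} {W} w X≈Y Z z = begin
    outcome ((W ⊕ X) ⊕ Z)  ≡⟨ ≅⇒outcome≡ (xy∙z≈y∙xz W X Z) ⟩
    outcome (X ⊕ (W ⊕ Z))  ≡⟨ X≈Y (W ⊕ Z) (sum-closed W Z w z) ⟩
    outcome (Y ⊕ (W ⊕ Z))  ≡⟨ ≅⇒outcome≡ (≅-sym (xy∙z≈y∙xz W Y Z)) ⟩
    outcome ((W ⊕ Y) ⊕ Z)  ∎
    where open ≡-Reasoning

  ≈-byOptions : ∀ {X Y} → Matched (_≈[ A ]_) X Y → X ≈[ A ] Y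
  ≈-byOptions {X} {Y} m Z z = go (≺-wellFounded Z) z
    where
    go : ∀ {Z} → Acc _≺_ Z → A Z → outcome (X ⊕ Z) ≡ outcome (Y ⊕ Z)
    go {Z} (acc rec) z = outcome-≡-byOptions {X ⊕ Z} {Y ⊕ Z} record { forth = forth′ ; back = back′ }
      where
      forth′ : ∀ {W} → W ≺ X ⊕ Z → ∃ λ W′ → W′ ≺ Y ⊕ Z × outcome W ≡ outcome W′
      forth′ w with optionOfSum X Z w
      ... | left x′  = let (Y′ , y′ , X′≈Y′) = forth m x′ in Y′ ⊕ Z , ≺-⊕ˡ Y Z y′ , X′≈Y′ Z z
      ... | right z′ = Y ⊕ _ , ≺-⊕ʳ Y Z z′ , go (rec z′) (option-closed Z _ z z′)
      back′ : ∀ {W′} → W′ ≺ Y ⊕ Z → ∃ λ W → W ≺ X ⊕ Z × outcome W ≡ outcome W′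
      back′ w′ with optionOfSum Y Z w′
      ... | left y′  = let (X′ , x′ , X′≈Y′) = back m y′ in X′ ⊕ Z , ≺-⊕ˡ X Z x′ , X′≈Y′ Z z
      ... | right z′ = X ⊕ _ , ≺-⊕ʳ X Z z′ , go (rec z′) (option-closed Z _ z z′)

module _ {A : GameSet} {G : Game} where

  -- A derivation b of X in cl(A ∪ {G}) writes X as a sum of games of A, proper subpositions of G and
  -- copies of G itself; plug b K replaces those copies of G by K.
  plug : ∀ {X} → Cl (A ∪｛ G ｝) X → Game → Game
  plug {X} (sub (inj₁ _) _)               _ = X
  plug     (sub (inj₂ refl) here)         K = K
  plug {X} (sub (inj₂ refl) (there _ _))  _ = X
  plug     (plus b c)                     K = plug b K ⊕ plug c K

  plug-G : ∀ {X} (b : Cl (A ∪｛ G ｝) X) → plug b G ≡ X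
  plug-G (sub (inj₁ _) _)              = refl
  plug-G (sub (inj₂ refl) here)        = refl
  plug-G (sub (inj₂ refl) (there _ _)) = refl
  plug-G (plus b c)                    = cong₂ _⊕_ (plug-G b) (plug-G c)

  module _ (closed : Closed A) (G-options : ∀ G′ → G′ ∈ options G → A G′) where
    open Closed closed

    plug-closed : ∀ {K X} → A K → (b : Cl (A ∪｛ G ｝) X) → A (plug b K)
    plug-closed k (sub (inj₁ x) p)               = subpos-closed closed x p
    plug-closed k (sub (inj₂ refl) here)         = k
    plug-closed k (sub (inj₂ refl) (there g′ p)) = subpos-closed closed (G-options _ g′) p
    plug-closed k (plus b c)                     = sum-closed _ _ (plug-closed k b) (plug-closed k c)

    normalForm : A 𝟘 → ∀ {X} (b : Cl (A ∪｛ G ｝) X) →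
                 ∃₂ λ a n → A a × (∀ K → plug b K ≅ a ⊕ (n · K))
    normalForm z b@(sub (inj₁ _) _)              = _ , 0 , plug-closed z b , λ _ → ≅-sym (identityʳ _)
    normalForm z (sub (inj₂ refl) here)          = 𝟘 , 1 , z , λ K → ≅-sym (≅-trans (identityˡ (1 · K)) (×-homo-1 K))
    normalForm z b@(sub (inj₂ refl) (there _ _)) = _ , 0 , plug-closed z b , λ _ → ≅-sym (identityʳ _)
    normalForm z (plus b c) with normalForm z b | normalForm z c
    ... | a , m , a∈A , b≅ | a′ , n , a′∈A , c≅ =
      a ⊕ a′ , m + n , sum-closed _ _ a∈A a′∈A , λ K → begin
      plug b K ⊕ plug c K               ≈⟨ ⊕-cong (b≅ K) (c≅ K) ⟩
      (a ⊕ (m · K)) ⊕ (a′ ⊕ (n · K))    ≈⟨ interchange a (m · K) a′ (n · K) ⟩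
      (a ⊕ a′) ⊕ ((m · K) ⊕ (n · K))    ≈⟨ ⊕-cong ≅-refl (≅-sym (×-homo-+ K m n)) ⟩
      (a ⊕ a′) ⊕ ((m + n) · K)          ∎
      where open ≅-Reasoning

module Substitution (A : GameSet) (closed : Closed A) (G : Game) (G-options : ∀ G′ → G′ ∈ options G → A G′)
         (H : Game) (H∈A : A H) (same : SameOptionClasses A G H) where

  𝟘∈A : A 𝟘
  𝟘∈A = 𝟘-closed closed H H∈A

  ·-≈ : ∀ n → (n · G) ≈[ A ] (n · H)
  ·-≈ zero    = λ _ _ → refl
  ·-≈ (suc n) = ≈-byOptions closed {suc n · G} {suc n · H} record { forth = forth′ ; back = back′ }
    where
    replace : ∀ G′ H′ → A G′ → G′ ≈[ A ] H′ → (G′ ⊕ (n · G)) ≈[ A ] (H′ ⊕ (n · H))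
    replace G′ H′ g′ G′≈H′ Z z = begin
      outcome ((G′ ⊕ (n · G)) ⊕ Z)  ≡⟨ ≈-⊕-congʳ closed g′ (·-≈ n) Z z ⟩
      outcome ((G′ ⊕ (n · H)) ⊕ Z)  ≡⟨ ≈-⊕-congˡ closed {G′} {H′} (·-closed closed 𝟘∈A H∈A n) G′≈H′ Z z ⟩
      outcome ((H′ ⊕ (n · H)) ⊕ Z)  ∎
      where open ≡-Reasoning
    forth′ : ∀ {W} → W ≺ suc n · G → ∃ λ W′ → W′ ≺ suc n · H × W ≈[ A ] W′
    forth′ w =
      let (G′ , g′ , W≅) = option-· G n w ; (H′ , h′ , G′≈H′) = proj₁ same G′ g′
      in H′ ⊕ (n · H) , ≺-⊕ˡ H (n · H) h′ ,
         λ Z z → trans (≅⇒outcome≡ (⊕-cong W≅ ≅-refl)) (replace G′ H′ (G-options G′ g′) G′≈H′ Z z)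
    back′ : ∀ {W} → W ≺ suc n · H → ∃ λ W′ → W′ ≺ suc n · G × W′ ≈[ A ] W
    back′ w =
      let (H′ , h′ , W≅) = option-· H n w ; (G′ , g′ , H′≈G′) = proj₂ same H′ h′
      in G′ ⊕ (n · G) , ≺-⊕ˡ G (n · G) g′ ,
         λ Z z → trans (replace G′ H′ (G-options G′ g′) (λ Y y → sym (H′≈G′ Y y)) Z z)
                       (≅⇒outcome≡ (⊕-cong (≅-sym W≅) ≅-refl))

  private
    B : GameSet
    B = Cl (A ∪｛ G ｝)

  inA : ∀ {X} → A X → B X
  inA x = sub (inj₁ x) here

  outcome-plug : ∀ {X} (b : B X) → outcome X ≡ outcome (plug b H)
  outcome-plug {X} b with normalForm closed G-options 𝟘∈A b
  ... | a , n , a∈A , b≅ = begin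
    outcome X              ≡⟨ cong outcome (sym (plug-G b)) ⟩
    outcome (plug b G)     ≡⟨ ≅⇒outcome≡ (≅-trans (b≅ G) (⊕-comm a (n · G))) ⟩
    outcome ((n · G) ⊕ a)  ≡⟨ ·-≈ n a a∈A ⟩
    outcome ((n · H) ⊕ a)  ≡⟨ ≅⇒outcome≡ (≅-sym (≅-trans (b≅ H) (⊕-comm a (n · H)))) ⟩
    outcome (plug b H)     ∎
    where open ≡-Reasoning

  plug-H-closed : ∀ {X} (b : B X) → A (plug b H)
  plug-H-closed = plug-closed closed G-options H∈A

  plug-cong : ∀ {X Y} (b : B X) (c : B Y) → X ≈[ B ] Y → plug b H ≈[ A ] plug c H
  plug-cong {X} {Y} b c X≈Y Z z = begin
    outcome (plug b H ⊕ Z)  ≡⟨ sym (outcome-plug (plus b (inA z))) ⟩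
    outcome (X ⊕ Z)         ≡⟨ X≈Y Z (inA z) ⟩
    outcome (Y ⊕ Z)         ≡⟨ outcome-plug (plus c (inA z)) ⟩
    outcome (plug c H ⊕ Z)  ∎
    where open ≡-Reasoning

  plug-reflects-≈ : ∀ {X Y} (b : B X) (c : B Y) → plug b H ≈[ A ] plug c H → X ≈[ B ] Y
  plug-reflects-≈ {X} {Y} b c b≈c Z z = begin
    outcome (X ⊕ Z)                ≡⟨ outcome-plug (plus b z) ⟩
    outcome (plug b H ⊕ plug z H)  ≡⟨ b≈c (plug z H) (plug-H-closed z) ⟩
    outcome (plug c H ⊕ plug z H)  ≡⟨ sym (outcome-plug (plus c z)) ⟩
    outcome (Y ⊕ Z)                ∎
    where open ≡-Reasoning

  plug-InPPortion : ∀ {X} (b : B X) → InPPortion B X ⇔ InPPortion A (plug b H)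
  plug-InPPortion b = mk⇔
    (λ (Y , y , Y≈X , Y𝒫) → plug y H , plug-H-closed y , plug-cong y b Y≈X , trans (sym (outcome-plug y)) Y𝒫)
    (λ (Y , y , Y≈ , Y𝒫) → Y , inA y , plug-reflects-≈ (inA y) b Y≈ , Y𝒫)

  plugIso : QuotientIso B A
  plugIso = record
    { ψ      = λ _ b → plug b H
    ; ψ-mem  = λ _ → plug-H-closed
    ; ψ-cong = λ _ _ → plug-cong
    ; ψ-inj  = λ _ _ → plug-reflects-≈
    ; ψ-surj = λ Y y → Y , inA y , λ _ _ → refl
    ; ψ-hom  = λ _ _ b c d → plug-cong d (plus b c) (λ _ _ → refl)
    ; ψ-unit = λ b → plug-cong b (inA 𝟘∈A) (λ _ _ → refl)
    ; ψ-P    = λ _ → plug-InPPortion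
    }

mainTheorem12 : (A : GameSet) → Closed A →
    (G : Game) → (∀ G′ → G′ ∈ options G → A G′) →
    (H : Game) → A H → SameOptionClasses A G H →
    Σ (QuotientIso (Cl (A ∪｛ G ｝)) A) λ I →
      (∀ X → A X → (c : Cl (A ∪｛ G ｝) X) → QuotientIso.ψ I X c ≈[ A ] X) ×
      ((c : Cl (A ∪｛ G ｝) G) → QuotientIso.ψ I G c ≈[ A ] H)
mainTheorem12 A closed G G-options H H∈A same =
  plugIso ,
  (λ X x c → plug-cong c (inA x) (λ _ _ → refl)) ,
  (λ c → plug-cong c (sub (inj₂ refl) here) (λ _ _ → refl))
  where open Substitution A closed G G-options H H∈A same
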